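{- Let $G$ be a finite group acting on a finite set $X$, and let $H$ be a subgroup of $G$. Then $$\#\{H\text{ -orbits of }X\}\le (G:H)\cdot \#\{G\text{ -orbits of }X\},$$ with equality if and only if $H_x=G_x$ for every $x\in X$.
   Context: For $x\in X$, $G_x=\{\sigma\in G:\sigma(x)=x\}$ is the stabilizer of $x$ in $G$, and $H_x=\{\sigma\in H:\sigma(x)=x\}$ is the stabilizer of $x$ in $H$. -}

module Defs where

open import Data.Nat using (ℕ)
open import Data.Fin using (Fin; _<_; _<?_)
open import Data.Fin.Properties using (_≟_; all?; any?)
open import Data.Vec using (count; allFin)
open import Data.Product using (Σ; ∃; _×_; _,_)
open import Relation.Binary.PropositionalEquality using (_≡_)
open import Relation.Nullary using (¬_; Dec)
open import Relation.Nullary.Decidable using (¬?; _→-dec_; _×-dec_)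
open import Relation.Unary using (Pred; Decidable)
open import Level using (0ℓ)

record FiniteGroup : Set where
  field
    order   : ℕ
    _·_     : Fin order → Fin order → Fin order
    e       : Fin order
    inv     : Fin order → Fin order
    assoc   : ∀ a b c → (a · b) · c ≡ a · (b · c)
    identˡ  : ∀ a → e · a ≡ a
    identʳ  : ∀ a → a · e ≡ a
    invˡ    : ∀ a → inv a · a ≡ e
    invʳ    : ∀ a → a · inv a ≡ e
  Elt : Set
  Elt = Fin order

record FiniteAction (G : FiniteGroup) : Set where
  open FiniteGroup G
  field
    size    : ℕ
    act     : Elt → Fin size → Fin size
    act-e   : ∀ x → act e x ≡ x
    act-·   : ∀ g h x → act (g · h) x ≡ act g (act h x)
  Pt : Set
  Pt = Fin size

record Subgroup (G : FiniteGroup) : Set₁ where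
  open FiniteGroup G
  field
    _∈H     : Pred Elt 0ℓ
    _∈H?    : Decidable _∈H
    e∈H     : e ∈H
    ·∈H     : ∀ {a b} → a ∈H → b ∈H → (a · b) ∈H
    inv∈H   : ∀ {a} → a ∈H → inv a ∈H

-- Number of equivalence classes of a (decidable) equivalence relation R on Fin k:
-- the number of a that are the least element of their class.
numClasses : (k : ℕ) (R : Fin k → Fin k → Set) → (∀ a b → Dec (R a b)) → ℕ
numClasses k R R? = count isRep? (allFin k)
  where
  isRep? : (a : Fin k) → Dec (∀ b → b < a → ¬ R a b)
  isRep? a = all? (λ b → (b <? a) →-dec ¬? (R? a b))

module _ {G : FiniteGroup} (A : FiniteAction G) (H : Subgroup G) where
  open FiniteGroup G
  open FiniteAction A
  open Subgroup H

  sameHOrbit : Pt → Pt → Set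
  sameHOrbit x y = ∃ λ h → h ∈H × act h x ≡ y

  sameHOrbit? : ∀ x y → Dec (sameHOrbit x y)
  sameHOrbit? x y = any? (λ h → (h ∈H?) ×-dec (act h x ≟ y))

  numHOrbits : ℕ
  numHOrbits = numClasses size sameHOrbit sameHOrbit?

  InStabilizer : Pt → Elt → Set
  InStabilizer x h = h ∈H × act h x ≡ x

module _ (G : FiniteGroup) where
  open FiniteGroup G

  whole : Subgroup G
  whole = record
    { _∈H = λ _ → Data.Unit.⊤ ; _∈H? = λ _ → Relation.Nullary.yes Data.Unit.tt
    ; e∈H = Data.Unit.tt ; ·∈H = λ _ _ → Data.Unit.tt ; inv∈H = λ _ → Data.Unit.tt }
    where import Data.Unit

module _ {G : FiniteGroup} (H : Subgroup G) where
  open FiniteGroup G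
  open Subgroup H

  sameLeftCoset : Elt → Elt → Set
  sameLeftCoset a b = ∃ λ h → h ∈H × a · h ≡ b

  sameLeftCoset? : ∀ a b → Dec (sameLeftCoset a b)
  sameLeftCoset? a b = any? (λ h → (h ∈H?) ×-dec ((a · h) ≟ b))

  index : ℕ
  index = numClasses order sameLeftCoset sameLeftCoset?

-- Fix a transversal of the left cosets aH and a representative r of every G-orbit.
-- Each H-orbit contains a point a⁻¹ r: if c y = r and c ∈ aH, say c h = a, then
-- a⁻¹ r = h⁻¹ y.  So (a , r) ↦ H·a⁻¹r maps a set of (G : H) · #(G-orbits) pairs onto
-- the H-orbits.  If h a⁻¹ r = a'⁻¹ r' then r = r' and a⁻¹ a' h fixes a⁻¹ r, so the map
-- is injective when G_x ⊆ H for all x; conversely if g fixes x and c x = r, the pairs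
-- (a , r) with a ∈ cH and with a ∈ c g⁻¹H have the same image, and coincide only if g ∈ H.
module Submission where

open import Defs
open import Algebra.Bundles using (Group)
import Algebra.Properties.Group as GroupProperties
open import Data.Nat using (ℕ; zero; suc; _≤_; _*_; s≤s)
open import Data.Nat.Properties using (≤-trans; ≤-reflexive; ≤-antisym; n≮n)
open import Data.Fin using (Fin; zero; suc; _<_; _<?_; punchOut; combine; remQuot)
open import Data.Fin.Properties using (_≟_; suc-injective; all?; any?; <-cmp; injective⇒≤; punchOut-injective; remQuot-combine; combine-remQuot)
open import Data.Vec using (Vec; []; _∷_; count; allFin; map; tabulate)
open import Data.Vec.Properties using (tabulate-allFin)
open import Data.Product using (Σ-syntax; ∃; _×_; _,_; proj₁; proj₂; uncurry)
import Data.Product as Product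
open import Data.Bool using (true; false)
open import Data.Unit using (tt)
open import Function using (_∘_)
open import Function.Bundles using (_⇔_; mk⇔; Equivalence)
open import Function.Definitions using (Injective)
open import Level using (0ℓ)
open import Relation.Binary.Core using (Rel)
open import Relation.Binary.Definitions using (tri<; tri≈; tri>)
open import Relation.Binary.Structures using (IsEquivalence)
open import Relation.Binary.PropositionalEquality
open import Relation.Binary.PropositionalEquality.Algebra using (isMagma)
open import Relation.Nullary using (¬_; Dec; yes; no; does; contradiction)
open import Relation.Nullary.Decidable using (¬?; _→-dec_)
open import Relation.Unary using (Pred; Decidable)

record Enumeration {D : Set} (P : Pred D 0ℓ) : Set where
  field
    size           : ℕ
    elem           : Fin size → D
    elem∈          : ∀ i → P (elem i)
    elem-injective : Injective _≡_ _≡_ elem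
    position       : ∀ {d} → P d → Fin size
    elem-position  : ∀ {d} (pd : P d) → elem (position pd) ≡ d

  position-injective : ∀ {d d'} (pd : P d) (pd' : P d') → position pd ≡ position pd' → d ≡ d'
  position-injective pd pd' eq =
    trans (sym (elem-position pd)) (trans (cong elem eq) (elem-position pd'))

open Enumeration using (size)

injective⇒surjective : ∀ {m n} (f : Fin m → Fin n) → Injective _≡_ _≡_ f → n ≤ m →
  ∀ y → ∃ λ x → f x ≡ y
injective⇒surjective {m} {suc n} f f-injective n≤m y with any? (λ x → f x ≟ y)
... | yes hit = hit
... | no miss = contradiction (≤-trans (s≤s (injective⇒≤ punchOut∘f-injective)) n≤m) (n≮n m)
  where
  y≢f : ∀ x → y ≢ f x
  y≢f x y≡fx = miss (x , sym y≡fx)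

  punchOut∘f-injective : Injective _≡_ _≡_ (λ x → punchOut (y≢f x))
  punchOut∘f-injective eq = f-injective (punchOut-injective (y≢f _) (y≢f _) eq)

count-map : ∀ {A B : Set} {P : Pred B 0ℓ} (P? : Decidable P) (f : A → B) {n} (xs : Vec A n) →
  count P? (map f xs) ≡ count (P? ∘ f) xs
count-map P? f []       = refl
count-map P? f (x ∷ xs) with does (P? (f x))
... | true  = cong suc (count-map P? f xs)
... | false = count-map P? f xs

count-tabulate : ∀ {A : Set} {P : Pred A 0ℓ} (P? : Decidable P) {n} (f : Fin n → A) →
  count P? (tabulate f) ≡ count (P? ∘ f) (allFin n)
count-tabulate P? {n} f = trans (cong (count P?) (tabulate-allFin f)) (count-map P? f (allFin n))

module _ {m} {P : Pred (Fin (suc m)) 0ℓ} (E : Enumeration (P ∘ suc)) where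
  private module E = Enumeration E

  extend-∉ : ¬ P zero → Enumeration P
  extend-∉ ¬P0 = record
    { size = E.size ; elem = suc ∘ E.elem ; elem∈ = E.elem∈
    ; elem-injective = λ eq → E.elem-injective (suc-injective eq)
    ; position = position ; elem-position = elem-position }
    where
    position : ∀ {d} → P d → Fin E.size
    position {zero}  P0 = contradiction P0 ¬P0
    position {suc d} pd = E.position pd
    elem-position : ∀ {d} (pd : P d) → suc (E.elem (position pd)) ≡ d
    elem-position {zero}  P0 = contradiction P0 ¬P0
    elem-position {suc d} pd = cong suc (E.elem-position pd)

  extend-∈ : P zero → Enumeration P
  extend-∈ P0 = record
    { size = suc E.size ; elem = elem ; elem∈ = elem∈ ; elem-injective = elem-injective
    ; position = position ; elem-position = elem-position }
    where
    elem : Fin (suc E.size) → Fin (suc m)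
    elem zero    = zero
    elem (suc i) = suc (E.elem i)
    elem∈ : ∀ i → P (elem i)
    elem∈ zero    = P0
    elem∈ (suc i) = E.elem∈ i
    elem-injective : Injective _≡_ _≡_ elem
    elem-injective {zero}  {zero}  _  = refl
    elem-injective {suc i} {suc j} eq = cong suc (E.elem-injective (suc-injective eq))
    position : ∀ {d} → P d → Fin (suc E.size)
    position {zero}  _  = zero
    position {suc d} pd = suc (E.position pd)
    elem-position : ∀ {d} (pd : P d) → elem (position pd) ≡ d
    elem-position {zero}  _  = refl
    elem-position {suc d} pd = cong suc (E.elem-position pd)

enumerate : ∀ {m} {P : Pred (Fin m) 0ℓ} (P? : Decidable P) →
  Σ[ E ∈ Enumeration P ] size E ≡ count P? (allFin m)
enumerate {zero} P? = record
  { size = 0 ; elem = λ () ; elem∈ = λ () ; elem-injective = λ { {()} }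
  ; position = λ { {()} } ; elem-position = λ { {()} } } , refl
enumerate {suc m} P? with enumerate (P? ∘ suc)
... | E , size≡ with P? zero
...   | yes P0 = extend-∈ E P0 , cong suc (trans size≡ (sym (count-tabulate P? suc)))
...   | no ¬P0 = extend-∉ E ¬P0 , trans size≡ (sym (count-tabulate P? suc))

_×ₑ_ : ∀ {A B : Set} {P : Pred A 0ℓ} {Q : Pred B 0ℓ} → Enumeration P → Enumeration Q →
  Enumeration (λ ab → P (proj₁ ab) × Q (proj₂ ab))
_×ₑ_ {P = P} {Q} EP EQ = record
  { size = EP.size * EQ.size
  ; elem = elem
  ; elem∈ = λ k → EP.elem∈ _ , EQ.elem∈ _
  ; elem-injective = elem-injective
  ; position = λ (pa , qb) → combine (EP.position pa) (EQ.position qb)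
  ; elem-position = λ (pa , qb) → elem-position pa qb }
  where
  module EP = Enumeration EP
  module EQ = Enumeration EQ
  open ≡-Reasoning

  elem : Fin (EP.size * EQ.size) → _
  elem = Product.map EP.elem EQ.elem ∘ remQuot EQ.size

  elem-injective : Injective _≡_ _≡_ elem
  elem-injective {k} {k'} eq = begin
    k                                        ≡⟨ combine-remQuot {EP.size} EQ.size k ⟨
    uncurry combine (remQuot {EP.size} _ k)  ≡⟨ cong (uncurry combine) (cong₂ _,_
                                                  (EP.elem-injective (cong proj₁ eq))
                                                  (EQ.elem-injective (cong proj₂ eq))) ⟩
    uncurry combine (remQuot {EP.size} _ k') ≡⟨ combine-remQuot {EP.size} EQ.size k' ⟩
    k'                                       ∎

  elem-position : ∀ {a b} (pa : P a) (qb : Q b) →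
    elem (combine (EP.position pa) (EQ.position qb)) ≡ (a , b)
  elem-position pa qb = trans
    (cong (Product.map EP.elem EQ.elem) (remQuot-combine (EP.position pa) (EQ.position qb)))
    (cong₂ _,_ (EP.elem-position pa) (EQ.elem-position qb))

InjectiveOn : {D E : Set} → Pred D 0ℓ → (D → E) → Set
InjectiveOn P f = ∀ {p p'} → P p → P p' → f p ≡ f p' → p ≡ p'

module _ {D E : Set} {P : Pred D 0ℓ} {Q : Pred E 0ℓ} (EP : Enumeration P) (EQ : Enumeration Q)
  (f : D → E) (f-onto : ∀ {q} → Q q → ∃ λ p → P p × f p ≡ q) where
  private
    module EP = Enumeration EP
    module EQ = Enumeration EQ

    preimage : Fin EQ.size → D
    preimage i = proj₁ (f-onto (EQ.elem∈ i))

    f-preimage : ∀ i → f (preimage i) ≡ EQ.elem i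
    f-preimage i = proj₂ (proj₂ (f-onto (EQ.elem∈ i)))

    section : Fin EQ.size → Fin EP.size
    section i = EP.position (proj₁ (proj₂ (f-onto (EQ.elem∈ i))))

    section-injective : Injective _≡_ _≡_ section
    section-injective {i} {j} eq = EQ.elem-injective (begin
      EQ.elem i         ≡⟨ f-preimage i ⟨
      f (preimage i)    ≡⟨ cong f (EP.position-injective _ _ eq) ⟩
      f (preimage j)    ≡⟨ f-preimage j ⟩
      EQ.elem j         ∎)
      where open ≡-Reasoning

  surjection⇒size-≤ : EQ.size ≤ EP.size
  surjection⇒size-≤ = injective⇒≤ section-injective

  size-≡⇒preimage : EQ.size ≡ EP.size → ∀ {p} → P p → ∃ λ i → preimage i ≡ p
  size-≡⇒preimage size≡ pp
    with injective⇒surjective section section-injective (≤-reflexive (sym size≡)) (EP.position pp)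
  ... | i , section-i≡ = i , EP.position-injective _ pp section-i≡

  size-≡⇒injectiveOn : EQ.size ≡ EP.size → InjectiveOn P f
  size-≡⇒injectiveOn size≡ pp pp' fp≡fp'
    with size-≡⇒preimage size≡ pp | size-≡⇒preimage size≡ pp'
  ... | i , refl | j , refl = cong preimage (EQ.elem-injective
    (trans (sym (f-preimage i)) (trans fp≡fp' (f-preimage j))))

  injectiveOn⇒size-≡ : (∀ {p} → P p → Q (f p)) → InjectiveOn P f → EQ.size ≡ EP.size
  injectiveOn⇒size-≡ f-into f-injective =
    ≤-antisym surjection⇒size-≤ (injective⇒≤ fposition-injective)
    where
    fposition-injective : Injective _≡_ _≡_ (λ j → EQ.position (f-into (EP.elem∈ j)))
    fposition-injective eq = EP.elem-injective
      (f-injective (EP.elem∈ _) (EP.elem∈ _) (EQ.position-injective _ _ eq))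

least-satisfying : ∀ {k} {P : Pred (Fin k) 0ℓ} → Decidable P → ∀ {x} → P x →
  Σ[ b ∈ Fin k ] P b × (∀ c → c < b → ¬ P c)
least-satisfying {suc k} P? Px with P? zero
... | yes P0 = zero , P0 , λ _ ()
least-satisfying {suc k} P? {zero}  P0 | no ¬P0 = contradiction P0 ¬P0
least-satisfying {suc k} {P} P? {suc x} Px | no ¬P0 with least-satisfying (P? ∘ suc) Px
... | b , Pb , below-b = suc b , Pb , below-suc-b
  where
  below-suc-b : ∀ c → c < suc b → ¬ P c
  below-suc-b zero    _         = ¬P0
  below-suc-b (suc c) (s≤s c<b) = below-b c c<b

-- IsRep and isRep? are literally those of numClasses, so representatives counts numClasses k R R?.
module Representatives {k : ℕ} {R : Rel (Fin k) 0ℓ} (R? : ∀ a b → Dec (R a b))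
  (isEquivalence : IsEquivalence R) where
  open IsEquivalence isEquivalence renaming (refl to R-refl; sym to R-sym; trans to R-trans)

  IsRep : Pred (Fin k) 0ℓ
  IsRep a = ∀ b → b < a → ¬ R a b

  isRep? : Decidable IsRep
  isRep? a = all? (λ b → (b <? a) →-dec ¬? (R? a b))

  representatives : Σ[ E ∈ Enumeration IsRep ] size E ≡ numClasses k R R?
  representatives = enumerate isRep?

  rep : Fin k → Fin k
  rep x = proj₁ (least-satisfying (R? x) (R-refl {x}))

  rep-related : ∀ x → R x (rep x)
  rep-related x = proj₁ (proj₂ (least-satisfying (R? x) (R-refl {x})))

  rep-isRep : ∀ x → IsRep (rep x)
  rep-isRep x c c<rep R-rep-c =
    proj₂ (proj₂ (least-satisfying (R? x) (R-refl {x}))) c c<rep (R-trans (rep-related x) R-rep-c)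

  isRep-unique : ∀ {b b'} → IsRep b → IsRep b' → R b b' → b ≡ b'
  isRep-unique {b} {b'} rep-b rep-b' Rbb' with <-cmp b b'
  ... | tri< b<b' _ _ = contradiction (R-sym Rbb') (rep-b' b b<b')
  ... | tri≈ _ b≡b' _ = b≡b'
  ... | tri> _ _ b>b' = contradiction Rbb' (rep-b b' b>b')

  rep-cong : ∀ {x y} → R x y → rep x ≡ rep y
  rep-cong {x} {y} Rxy =
    isRep-unique (rep-isRep x) (rep-isRep y) (R-trans (R-sym (rep-related x)) (R-trans Rxy (rep-related y)))

  rep-idem : ∀ {y} → IsRep y → rep y ≡ y
  rep-idem {y} rep-y = isRep-unique (rep-isRep y) rep-y (R-sym (rep-related y))

  rep-≡⇒related : ∀ {x y} → rep x ≡ rep y → R x y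
  rep-≡⇒related {x} {y} eq = R-trans (subst (R x) eq (rep-related x)) (R-sym (rep-related y))

group : FiniteGroup → Group 0ℓ 0ℓ
group G = record
  { isGroup = record
    { isMonoid = record
      { isSemigroup = record { isMagma = isMagma _·_ ; assoc = assoc }
      ; identity = identˡ , identʳ }
    ; inverse = invˡ , invʳ
    ; ⁻¹-cong = cong inv } }
  where open FiniteGroup G

module ActionProperties {G : FiniteGroup} (A : FiniteAction G) where
  open FiniteGroup G
  open FiniteAction A

  act-compose : ∀ {g h x y z} → act g x ≡ y → act h y ≡ z → act (h · g) x ≡ z
  act-compose {g} {h} {x} refl refl = act-· h g x

  act-inv-cancelˡ : ∀ g x → act (inv g) (act g x) ≡ x
  act-inv-cancelˡ g x = trans (sym (act-· _ _ _)) (trans (cong (λ z → act z x) (invˡ g)) (act-e x))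

  act-inv-cancelʳ : ∀ g x → act g (act (inv g) x) ≡ x
  act-inv-cancelʳ g x = trans (sym (act-· _ _ _)) (trans (cong (λ z → act z x) (invʳ g)) (act-e x))

  act-inv-move : ∀ {g x y} → act g x ≡ y → act (inv g) y ≡ x
  act-inv-move {g} {x} refl = act-inv-cancelˡ g x

  sameHOrbit-isEquivalence : (H : Subgroup G) → IsEquivalence (sameHOrbit A H)
  sameHOrbit-isEquivalence H = record
    { refl  = λ {x} → e , e∈H , act-e x
    ; sym   = λ (h , h∈H , hx≡y) → inv h , inv∈H h∈H , act-inv-move hx≡y
    ; trans = λ (h , h∈H , hx≡y) (h' , h'∈H , h'y≡z) → h' · h , ·∈H h'∈H h∈H , act-compose hx≡y h'y≡z }
    where open Subgroup H

module CosetProperties {G : FiniteGroup} (H : Subgroup G) where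
  open FiniteGroup G
  open Subgroup H
  open GroupProperties (group G)

  sameLeftCoset⇒inv·∈ : ∀ {a b} → sameLeftCoset H a b → (inv a · b) ∈H
  sameLeftCoset⇒inv·∈ {a} {b} (h , h∈H , ah≡b) = subst _∈H (y≈x\\z a h b ah≡b) h∈H

  inv·∈⇒sameLeftCoset : ∀ {a b} → (inv a · b) ∈H → sameLeftCoset H a b
  inv·∈⇒sameLeftCoset {a} {b} a⁻¹b∈H = inv a · b , a⁻¹b∈H , \\-leftDividesˡ a b

  sameLeftCoset-isEquivalence : IsEquivalence (sameLeftCoset H)
  sameLeftCoset-isEquivalence = record
    { refl  = λ {a} → e , e∈H , identʳ a
    ; sym   = λ {a} (h , h∈H , ah≡b) → inv h , inv∈H h∈H , sym (x≈z//y a h _ ah≡b)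
    ; trans = λ (h , h∈H , ah≡b) (h' , h'∈H , bh'≡c) →
        h · h' , ·∈H h∈H h'∈H , trans (sym (assoc _ _ _)) (trans (cong (_· h') ah≡b) bh'≡c) }

module _ {G : FiniteGroup} (A : FiniteAction G) (H : Subgroup G) where
  open FiniteGroup G
  open FiniteAction A hiding (size)
  open Subgroup H
  open GroupProperties (group G)
  open ActionProperties A
  open CosetProperties H
  private
    module Coset  = Representatives (sameLeftCoset? H) sameLeftCoset-isEquivalence
    module HOrbit = Representatives (sameHOrbit? A H) (sameHOrbit-isEquivalence H)
    module GOrbit = Representatives (sameHOrbit? A (whole G)) (sameHOrbit-isEquivalence (whole G))

  IsLabel : Pred (Elt × Pt) 0ℓ
  IsLabel ar = Coset.IsRep (proj₁ ar) × GOrbit.IsRep (proj₂ ar)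

  hOrbitRep : Elt × Pt → Pt
  hOrbitRep (a , r) = HOrbit.rep (act (inv a) r)

  StabilizersAgree : Set
  StabilizersAgree = ∀ x → ∀ g → InStabilizer A H x g ⇔ InStabilizer A (whole G) x g

  coset-translate : ∀ {c a y r} → sameLeftCoset H c a → act c y ≡ r →
    sameHOrbit A H y (act (inv a) r)
  coset-translate {c} {a} {y} {r} (h , h∈H , ch≡a) cy≡r = inv h , inv∈H h∈H , sym (begin
    act (inv a) r           ≡⟨ cong (λ z → act (inv z) r) ch≡a ⟨
    act (inv (c · h)) r     ≡⟨ cong (λ z → act z r) (⁻¹-anti-homo-∙ c h) ⟩
    act (inv h · inv c) r   ≡⟨ act-· _ _ _ ⟩
    act (inv h) (act (inv c) r) ≡⟨ cong (act (inv h)) (act-inv-move cy≡r) ⟩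
    act (inv h) y           ∎)
    where open ≡-Reasoning

  hOrbitRep-of-label : ∀ {c y} → act c y ≡ GOrbit.rep y →
    hOrbitRep (Coset.rep c , GOrbit.rep y) ≡ HOrbit.rep y
  hOrbitRep-of-label {c} cy≡r = sym (HOrbit.rep-cong (coset-translate (Coset.rep-related c) cy≡r))

  hOrbitRep-onto : ∀ {q} → HOrbit.IsRep q → ∃ λ l → IsLabel l × hOrbitRep l ≡ q
  hOrbitRep-onto {q} rep-q with GOrbit.rep-related q
  ... | c , _ , cq≡r = (Coset.rep c , GOrbit.rep q) , (Coset.rep-isRep c , GOrbit.rep-isRep q) ,
    trans (hOrbitRep-of-label cq≡r) (HOrbit.rep-idem rep-q)

  hOrbitRep-injectiveOn : StabilizersAgree → InjectiveOn IsLabel hOrbitRep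
  hOrbitRep-injectiveOn agree {a , r} {a' , r'} (rep-a , rep-r) (rep-a' , rep-r') same-rep
    with HOrbit.rep-≡⇒related same-rep
  ... | h , h∈H , hx≡x' = cong₂ _,_ a≡a' r≡r'
    where
    x : Pt
    x = act (inv a) r
    a'h-x≡r' : act (a' · h) x ≡ r'
    a'h-x≡r' = act-compose hx≡x' (act-inv-cancelʳ a' r')
    r≡r' : r ≡ r'
    r≡r' = GOrbit.isRep-unique rep-r rep-r' ((a' · h) · inv a , tt , act-compose refl a'h-x≡r')
    k : Elt
    k = inv a · (a' · h)
    k∈H : k ∈H
    k∈H = proj₁ (Equivalence.from (agree x k)
      (tt , act-compose a'h-x≡r' (cong (act (inv a)) (sym r≡r'))))
    k·h⁻¹≡a⁻¹a' : k · inv h ≡ inv a · a'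
    k·h⁻¹≡a⁻¹a' = trans (assoc _ _ _) (cong (inv a ·_) (//-rightDividesʳ h a'))
    a≡a' : a ≡ a'
    a≡a' = Coset.isRep-unique rep-a rep-a' (inv·∈⇒sameLeftCoset
      (subst _∈H k·h⁻¹≡a⁻¹a' (·∈H k∈H (inv∈H h∈H))))

  stabilizersAgree : InjectiveOn IsLabel hOrbitRep → StabilizersAgree
  stabilizersAgree injective x g = mk⇔ (λ (_ , gx≡x) → tt , gx≡x) (λ (_ , gx≡x) → fixer∈H gx≡x , gx≡x)
    where
    fixer∈H : act g x ≡ x → g ∈H
    fixer∈H gx≡x with GOrbit.rep-related x
    ... | c , _ , cx≡r = subst _∈H (⁻¹-involutive g) (inv∈H g⁻¹∈H)
      where
      same-label : Coset.rep c ≡ Coset.rep (c · inv g)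
      same-label = cong proj₁ (injective
        (Coset.rep-isRep c , GOrbit.rep-isRep x) (Coset.rep-isRep (c · inv g) , GOrbit.rep-isRep x)
        (trans (hOrbitRep-of-label cx≡r)
               (sym (hOrbitRep-of-label (act-compose (act-inv-move gx≡x) cx≡r)))))
      g⁻¹∈H : inv g ∈H
      g⁻¹∈H = subst _∈H (\\-leftDividesʳ c (inv g))
        (sameLeftCoset⇒inv·∈ (Coset.rep-≡⇒related same-label))

  orbit-count : (numHOrbits A H ≤ index H * numHOrbits A (whole G))
    × (numHOrbits A H ≡ index H * numHOrbits A (whole G) ⇔ StabilizersAgree)
  orbit-count = subst₂ (λ m n → (m ≤ n) × (m ≡ n ⇔ StabilizersAgree)) size-hOrbits size-labels
    ( surjection⇒size-≤ labels hOrbits hOrbitRep hOrbitRep-onto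
    , mk⇔ (stabilizersAgree ∘ size-≡⇒injectiveOn labels hOrbits hOrbitRep hOrbitRep-onto)
          (injectiveOn⇒size-≡ labels hOrbits hOrbitRep hOrbitRep-onto
             (λ _ → HOrbit.rep-isRep _) ∘ hOrbitRep-injectiveOn) )
    where
    labels : Enumeration IsLabel
    labels = proj₁ Coset.representatives ×ₑ proj₁ GOrbit.representatives
    hOrbits : Enumeration HOrbit.IsRep
    hOrbits = proj₁ HOrbit.representatives
    size-hOrbits : size hOrbits ≡ numHOrbits A H
    size-hOrbits = proj₂ HOrbit.representatives
    size-labels : size labels ≡ index H * numHOrbits A (whole G)
    size-labels = cong₂ _*_ (proj₂ Coset.representatives) (proj₂ GOrbit.representatives)

lemma10 : (G : FiniteGroup) (A : FiniteAction G) (H : Subgroup G) →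
    (numHOrbits A H ≤ index H * numHOrbits A (whole G))
    × (numHOrbits A H ≡ index H * numHOrbits A (whole G)
       ⇔ (∀ x → ∀ g → InStabilizer A H x g ⇔ InStabilizer A (whole G) x g))
lemma10 G A H = orbit-count A H
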